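{- Let $i\ge 7$. Every occurrence of $F_{i-3}$ in $F_i$ is immediately followed by $Q_{i-1}$; that is, whenever $F_{i-3}$ occurs at position $p$ of $F_i$, the string $F_{i-3}\,Q_{i-1}$ also occurs at position $p$.
   Context: Fibonacci words: $F_1=\texttt{b}$, $F_2=\texttt{a}$, $F_k=F_{k-1}F_{k-2}$ for $k\ge 3$. For $k\ge 6$, $Q_k:=F_{k-5}F_{k-6}\cdots F_3F_2$ (concatenation with decreasing indices from $k-5$ down to $2$), where $Q_6$ is the empty string. Positions are 1-indexed; $S$ occurs at position $p$ in $T$ if $T[p\ldots p+|S|-1]=S$. -}

module Defs where

open import Data.Nat using (ℕ; zero; suc; _∸_)
open import Data.List using (List; []; _∷_; _++_; length)
open import Data.Product using (Σ; _×_; ∃-syntax)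
open import Relation.Binary.PropositionalEquality using (_≡_)

data Letter : Set where
  a b : Letter

-- Fibonacci words: F 1 = b, F 2 = a, F k = F (k-1) ++ F (k-2) for k ≥ 3.
-- F 0 is an unused junk value (the paper only uses indices ≥ 1).
F : ℕ → List Letter
F zero = []
F (suc zero) = b ∷ []
F (suc (suc zero)) = a ∷ []
F (suc (suc (suc k))) = F (suc (suc k)) ++ F (suc k)

Qs : ℕ → List Letter
Qs zero = []
Qs (suc zero) = []
Qs (suc (suc n)) = F (suc (suc n)) ++ Qs (suc n)

-- Q k = F (k-5) F (k-6) ... F 2  (meaningful for k ≥ 6; Q 6 is empty)
Q : ℕ → List Letter
Q k = Qs (k ∸ 5)

-- S occurs at (1-indexed) position p in T: T[p .. p+|S|-1] = S
OccursAt : List Letter → List Letter → ℕ → Set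
OccursAt S T p = Σ ℕ λ q → (p ≡ suc q) ×
  (∃[ u ] ∃[ v ] (length u ≡ q × T ≡ u ++ S ++ v))

{-# OPTIONS --safe #-}
module Submission where

open import Defs
open import Data.Nat using (ℕ; _≤_; _∸_; zero; suc; s≤s; z≤n; _+_)
open import Data.List using (List; []; _∷_; _++_; [_])
open import Data.List.Properties using (∷-injectiveʳ; ∷ʳ-injective; ++-assoc)
open import Data.Product using (∃-syntax; _×_; _,_)
open import Data.Sum using (_⊎_; inj₁; inj₂)
open import Data.Empty using (⊥-elim)
open import Relation.Binary.PropositionalEquality using (_≡_; _≢_; refl; sym; trans; cong; cong₂; module ≡-Reasoning)

-- The Fibonacci morphism φ : a ↦ ab, b ↦ a maps F n to F (n+1) and
-- F (i-3) ++ Q (i-1) ++ a to F (i-2) ++ Q i. Hence an occurrence of F (i-3) in F i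
-- followed by Q (i-1) is mapped to an occurrence of F (i-2) in F (i+1) followed by
-- Q i, provided the image of what comes next starts with a; the invariant
-- Prolongable keeps this true along the induction. Conversely every occurrence of
-- F (i-2) in F (i+1) is such an image: φ is recognizable, and its only ambiguity
-- (φ b = a is a prefix of φ a) would force the factor aaa into F i, which
-- φ-images of bb-free words avoid. The induction starts by inspecting F 7.

φ : List Letter → List Letter
φ [] = []
φ (a ∷ t) = a ∷ b ∷ φ t
φ (b ∷ t) = a ∷ φ t

φ-++ : ∀ x y → φ (x ++ y) ≡ φ x ++ φ y
φ-++ [] y = refl
φ-++ (a ∷ x) y = cong (λ z → a ∷ b ∷ z) (φ-++ x y)
φ-++ (b ∷ x) y = cong (a ∷_) (φ-++ x y)

φ-F : ∀ n → φ (F (suc n)) ≡ F (suc (suc n))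
φ-F zero = refl
φ-F (suc zero) = refl
φ-F (suc (suc n)) = trans (φ-++ (F (suc (suc n))) (F (suc n)))
  (cong₂ _++_ (φ-F (suc n)) (φ-F n))

φ-Qs : ∀ m → φ (Qs (suc m)) ++ [ a ] ≡ Qs (suc (suc m))
φ-Qs zero = refl
φ-Qs (suc m) = begin
  φ (F (2 + m) ++ Qs (suc m)) ++ [ a ]      ≡⟨ cong (_++ [ a ]) (φ-++ (F (2 + m)) (Qs (suc m))) ⟩
  (φ (F (2 + m)) ++ φ (Qs (suc m))) ++ [ a ] ≡⟨ ++-assoc (φ (F (2 + m))) (φ (Qs (suc m))) [ a ] ⟩
  φ (F (2 + m)) ++ φ (Qs (suc m)) ++ [ a ]   ≡⟨ cong₂ _++_ (φ-F (suc m)) (φ-Qs m) ⟩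
  F (3 + m) ++ Qs (2 + m)                    ∎
  where open ≡-Reasoning

φ-Qs-++ : ∀ m {v v'} → φ v ≡ a ∷ v' → φ (Qs (suc m) ++ v) ≡ Qs (suc (suc m)) ++ v'
φ-Qs-++ m {v} {v'} φv = begin
  φ (Qs (suc m) ++ v)               ≡⟨ φ-++ (Qs (suc m)) v ⟩
  φ (Qs (suc m)) ++ φ v             ≡⟨ cong (φ (Qs (suc m)) ++_) φv ⟩
  φ (Qs (suc m)) ++ [ a ] ++ v'     ≡⟨ ++-assoc (φ (Qs (suc m))) [ a ] v' ⟨
  (φ (Qs (suc m)) ++ [ a ]) ++ v'   ≡⟨ cong (_++ v') (φ-Qs m) ⟩
  Qs (suc (suc m)) ++ v'            ∎
  where open ≡-Reasoning

φ-≢b∷ : ∀ t y → φ t ≢ b ∷ y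
φ-≢b∷ [] y ()
φ-≢b∷ (a ∷ t) y ()
φ-≢b∷ (b ∷ t) y ()

data Prolongable : List Letter → Set where
  a∷_∷_ : ∀ y r → Prolongable (a ∷ y ∷ r)
  b∷a∷_ : ∀ r → Prolongable (b ∷ a ∷ r)

φ-Prolongable : ∀ {v} → Prolongable v → ∃[ v' ] φ v ≡ a ∷ v' × Prolongable v'
φ-Prolongable (a∷ a ∷ r) = _ , refl , b∷a∷ _
φ-Prolongable (a∷ b ∷ r) = _ , refl , b∷a∷ _
φ-Prolongable (b∷a∷ r) = _ , refl , a∷ b ∷ φ r

-- Each a of φ T begins the image of a letter of T.
φ-split-at-a : ∀ T u' z → φ T ≡ u' ++ a ∷ z → ∃[ u ] ∃[ t ] T ≡ u ++ t × φ t ≡ a ∷ z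
φ-split-at-a T [] z e = [] , T , refl , e
φ-split-at-a [] (_ ∷ _) z ()
φ-split-at-a (a ∷ T) (_ ∷ []) z ()
φ-split-at-a (a ∷ T) (_ ∷ _ ∷ u') z e with φ-split-at-a T u' z (∷-injectiveʳ (∷-injectiveʳ e))
... | u , t , refl , φt = a ∷ u , t , refl , φt
φ-split-at-a (b ∷ T) (_ ∷ u') z e with φ-split-at-a T u' z (∷-injectiveʳ e)
... | u , t , refl , φt = b ∷ u , t , refl , φt

φ-cancelˡ : ∀ S t w → φ t ≡ φ S ++ w →
  (∃[ t' ] t ≡ S ++ t' × φ t' ≡ w) ⊎ (∃[ S' ] ∃[ t' ] S ≡ S' ++ [ b ] × t ≡ S' ++ a ∷ t')
φ-cancelˡ [] t w e = inj₁ (t , refl , e)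
φ-cancelˡ (a ∷ S) [] w ()
φ-cancelˡ (b ∷ S) [] w ()
φ-cancelˡ (a ∷ S) (a ∷ t) w e with φ-cancelˡ S t w (∷-injectiveʳ (∷-injectiveʳ e))
... | inj₁ (t' , refl , φt') = inj₁ (t' , refl , φt')
... | inj₂ (S' , t' , refl , refl) = inj₂ (a ∷ S' , t' , refl , refl)
φ-cancelˡ (b ∷ S) (b ∷ t) w e with φ-cancelˡ S t w (∷-injectiveʳ e)
... | inj₁ (t' , refl , φt') = inj₁ (t' , refl , φt')
... | inj₂ (S' , t' , refl , refl) = inj₂ (b ∷ S' , t' , refl , refl)
φ-cancelˡ (a ∷ S) (b ∷ t) w e = ⊥-elim (φ-≢b∷ t _ (∷-injectiveʳ e))
φ-cancelˡ (b ∷ []) (a ∷ t) w e = inj₂ ([] , t , refl , refl)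
φ-cancelˡ (b ∷ a ∷ S) (a ∷ t) w ()
φ-cancelˡ (b ∷ b ∷ S) (a ∷ t) w ()

φ-occurrence : ∀ {r} T S u' w → φ S ≡ a ∷ r → φ T ≡ u' ++ φ S ++ w →
  (∃[ u ] ∃[ t' ] T ≡ u ++ S ++ t' × φ t' ≡ w) ⊎
  (∃[ u ] ∃[ S' ] ∃[ t' ] S ≡ S' ++ [ b ] × T ≡ u ++ S' ++ a ∷ t')
φ-occurrence {r} T S u' w φS e
  with φ-split-at-a T u' (r ++ w) (trans e (cong (λ z → u' ++ z ++ w) φS))
... | u , t , refl , φt with φ-cancelˡ S t w (trans φt (cong (_++ w) (sym φS)))
...   | inj₁ (t' , refl , φt') = inj₁ (u , t' , refl , φt')
...   | inj₂ (S' , t' , eS , refl) = inj₂ (u , S' , t' , eS , refl)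

Avoids : List Letter → List Letter → Set
Avoids s T = ∀ x y → T ≢ x ++ s ++ y

φ-avoids-bb : ∀ T → Avoids (b ∷ b ∷ []) (φ T)
φ-avoids-bb [] [] y ()
φ-avoids-bb [] (_ ∷ _) y ()
φ-avoids-bb (a ∷ T) [] y ()
φ-avoids-bb (a ∷ T) (_ ∷ []) y e = φ-≢b∷ T y (∷-injectiveʳ (∷-injectiveʳ e))
φ-avoids-bb (a ∷ T) (_ ∷ _ ∷ x) y e = φ-avoids-bb T x y (∷-injectiveʳ (∷-injectiveʳ e))
φ-avoids-bb (b ∷ T) [] y ()
φ-avoids-bb (b ∷ T) (_ ∷ x) y e = φ-avoids-bb T x y (∷-injectiveʳ e)

φ-avoids-aaa : ∀ T → Avoids (b ∷ b ∷ []) T → Avoids (a ∷ a ∷ a ∷ []) (φ T)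
φ-avoids-aaa [] _ [] y ()
φ-avoids-aaa [] _ (_ ∷ _) y ()
φ-avoids-aaa (a ∷ T) _ [] y ()
φ-avoids-aaa (a ∷ T) _ (_ ∷ []) y ()
φ-avoids-aaa (a ∷ T) bb∉ (_ ∷ _ ∷ x) y e =
  φ-avoids-aaa T (λ x' y' e' → bb∉ (a ∷ x') y' (cong (a ∷_) e')) x y (∷-injectiveʳ (∷-injectiveʳ e))
φ-avoids-aaa (b ∷ []) _ [] y ()
φ-avoids-aaa (b ∷ a ∷ T) _ [] y ()
φ-avoids-aaa (b ∷ b ∷ T) bb∉ [] y e = bb∉ [] T refl
φ-avoids-aaa (b ∷ T) bb∉ (_ ∷ x) y e =
  φ-avoids-aaa T (λ x' y' e' → bb∉ (b ∷ x') y' (cong (b ∷_) e')) x y (∷-injectiveʳ e)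

F-avoids-aaa : ∀ n → Avoids (a ∷ a ∷ a ∷ []) (F (3 + n))
F-avoids-aaa n x y e = φ-avoids-aaa (F (2 + n))
  (λ x' y' e' → φ-avoids-bb (F (suc n)) x' y' (trans (φ-F n) e'))
  x y (trans (φ-F (suc n)) e)

F-head : ∀ n → ∃[ r ] F (suc (suc n)) ≡ a ∷ r
F-head zero = _ , refl
F-head (suc n) with F-head n
... | r , e = r ++ F (suc n) , cong (_++ F (suc n)) e

F-last : ∀ j → ∃[ P ] (F (4 + j) ≡ P ++ a ∷ a ∷ b ∷ [] ⊎ F (4 + j) ≡ P ++ a ∷ b ∷ a ∷ [])
F-last zero = [] , inj₂ refl
F-last (suc zero) = a ∷ b ∷ [] , inj₁ refl
F-last (suc (suc j)) with F-last j
... | P , inj₁ e = F (5 + j) ++ P , inj₁ (trans (cong (F (5 + j) ++_) e) (sym (++-assoc (F (5 + j)) P _)))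
... | P , inj₂ e = F (5 + j) ++ P , inj₂ (trans (cong (F (5 + j) ++_) e) (sym (++-assoc (F (5 + j)) P _)))

F-last-b : ∀ j S → F (4 + j) ≡ S ++ [ b ] → ∃[ P ] S ≡ P ++ a ∷ a ∷ []
F-last-b j S e with F-last j
... | P , inj₁ e' with ∷ʳ-injective S (P ++ a ∷ a ∷ []) (trans (sym e) (trans e' (sym (++-assoc P _ _))))
...   | S≡ , _ = P , S≡
F-last-b j S e | P , inj₂ e' with ∷ʳ-injective S (P ++ a ∷ b ∷ []) (trans (sym e) (trans e' (sym (++-assoc P _ _))))
...   | _ , ()

F7-F4-Prolongable : ∀ u w → F 7 ≡ u ++ F 4 ++ w → Prolongable w
F7-F4-Prolongable [] _ refl = a∷ _ ∷ _
F7-F4-Prolongable (_ ∷ []) _ ()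
F7-F4-Prolongable (_ ∷ _ ∷ []) _ ()
F7-F4-Prolongable (_ ∷ _ ∷ _ ∷ []) _ refl = b∷a∷ _
F7-F4-Prolongable (_ ∷ _ ∷ _ ∷ _ ∷ []) _ ()
F7-F4-Prolongable (_ ∷ _ ∷ _ ∷ _ ∷ _ ∷ []) _ refl = a∷ _ ∷ _
F7-F4-Prolongable (_ ∷ _ ∷ _ ∷ _ ∷ _ ∷ _ ∷ []) _ ()
F7-F4-Prolongable (_ ∷ _ ∷ _ ∷ _ ∷ _ ∷ _ ∷ _ ∷ []) _ ()
F7-F4-Prolongable (_ ∷ _ ∷ _ ∷ _ ∷ _ ∷ _ ∷ _ ∷ _ ∷ []) _ refl = a∷ _ ∷ _
F7-F4-Prolongable (_ ∷ _ ∷ _ ∷ _ ∷ _ ∷ _ ∷ _ ∷ _ ∷ _ ∷ []) _ ()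
F7-F4-Prolongable (_ ∷ _ ∷ _ ∷ _ ∷ _ ∷ _ ∷ _ ∷ _ ∷ _ ∷ _ ∷ []) _ ()
F7-F4-Prolongable (_ ∷ _ ∷ _ ∷ _ ∷ _ ∷ _ ∷ _ ∷ _ ∷ _ ∷ _ ∷ _ ∷ []) _ ()
F7-F4-Prolongable (_ ∷ _ ∷ _ ∷ _ ∷ _ ∷ _ ∷ _ ∷ _ ∷ _ ∷ _ ∷ _ ∷ _ ∷ []) _ ()
F7-F4-Prolongable (_ ∷ _ ∷ _ ∷ _ ∷ _ ∷ _ ∷ _ ∷ _ ∷ _ ∷ _ ∷ _ ∷ _ ∷ _ ∷ []) _ ()
F7-F4-Prolongable (_ ∷ _ ∷ _ ∷ _ ∷ _ ∷ _ ∷ _ ∷ _ ∷ _ ∷ _ ∷ _ ∷ _ ∷ _ ∷ _ ∷ _) _ ()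

F-occurrence-desubstitute : ∀ j u' w → F (8 + j) ≡ u' ++ F (5 + j) ++ w →
  ∃[ u ] ∃[ t ] F (7 + j) ≡ u ++ F (4 + j) ++ t × φ t ≡ w
F-occurrence-desubstitute j u' w e with F-head (3 + j)
... | r , F5≡a∷r with φ-occurrence (F (7 + j)) (F (4 + j)) u' w (trans (φ-F (3 + j)) F5≡a∷r)
                       (trans (φ-F (6 + j)) (trans e (cong (λ z → u' ++ z ++ w) (sym (φ-F (3 + j))))))
...   | inj₁ occurrence = occurrence
...   | inj₂ (u , S , t , F4≡ , F7≡) with F-last-b j S F4≡
...     | P , refl = ⊥-elim (F-avoids-aaa (4 + j) (u ++ P) t (begin
  F (7 + j)                          ≡⟨ F7≡ ⟩
  u ++ (P ++ a ∷ a ∷ []) ++ a ∷ t    ≡⟨ cong (u ++_) (++-assoc P (a ∷ a ∷ []) (a ∷ t)) ⟩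
  u ++ P ++ a ∷ a ∷ a ∷ t            ≡⟨ ++-assoc u P _ ⟨
  (u ++ P) ++ a ∷ a ∷ a ∷ t          ∎))
  where open ≡-Reasoning

F-occurrence-followed-by-Qs : ∀ j u w → F (7 + j) ≡ u ++ F (4 + j) ++ w →
  ∃[ v ] w ≡ Qs (suc j) ++ v × Prolongable v
F-occurrence-followed-by-Qs zero u w e = w , refl , F7-F4-Prolongable u w e
F-occurrence-followed-by-Qs (suc j) u' w e with F-occurrence-desubstitute j u' w e
... | u , t , F7≡ , refl with F-occurrence-followed-by-Qs j u t F7≡
...   | v , refl , pv with φ-Prolongable pv
...     | v' , φv≡a∷v' , pv' = v' , φ-Qs-++ j φv≡a∷v' , pv'

lemma28 : (i : ℕ) → 7 ≤ i → (p : ℕ) →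
    OccursAt (F (i ∸ 3)) (F i) p → OccursAt (F (i ∸ 3) ++ Q (i ∸ 1)) (F i) p
lemma28 .(7 + j) (s≤s (s≤s (s≤s (s≤s (s≤s (s≤s (s≤s {n = j} z≤n))))))) p (q , p≡ , u , w , |u| , F≡)
  with F-occurrence-followed-by-Qs j u w F≡
... | v , refl , _ = q , p≡ , u , v , |u| , trans F≡ (cong (u ++_) (sym (++-assoc (F (4 + j)) (Qs (suc j)) v)))
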